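{- Let $\mathfrak{g}$ be of type $E_6^{(1)}$ (Kac labeling, affine node $0$ attached to node $2$, with $1,3,4,5,6$ the long chain and $2$ attached to $4$), let $s \in \mathbb{Z}_{>0}$, and consider the Kirillov--Reshetikhin crystal $B^{4,s}$, graded by the cocharge statistic on its highest weight rigged configurations. Let $q^k B(\overline{\Lambda}_r)$ denote that the highest weight $U_q(\mathfrak{g}_0)$-crystal $B(\overline{\Lambda}_r)$ is given a grading of $k$, where $\overline{\Lambda}_a$ are the fundamental weights of the classical (finite type $E_6$) subalgebra $\mathfrak{g}_0$. Then, as graded $U_q(\mathfrak{g}_0)$-crystals, \begin{align*} B^{4,s} & \cong \bigoplus_{\substack{j_1+j_2+2j_3+j_4 \leq s \\ j_1,j_2,j_3,j_4 \in \mathbb{Z}_{\geq 0}}} \min(1 + j_2, 1 + s - j_1 - j_2 - 2j_3 - j_4)\, q^{3s - 2j_1 - 3j_2 - 4j_3 - 2j_4} \\ & \hspace{75pt} \times \sum_{k=0}^{j_1} q^k B\bigl(j_1 \overline{\Lambda}_2 + j_2 \overline{\Lambda}_4 + j_3 (\overline{\Lambda}_3 + \overline{\Lambda}_5) + j_4 (\overline{\Lambda}_1 + \overline{\Lambda}_6)\bigr). \end{align*}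
   Context: Here the grading on $B^{4,s}$ comes from the set of highest weight rigged configurations $\mathrm{RC}(B^{4,s})$ and their cocharge. Explicitly, with $\overline{\alpha}_a$ the simple roots of $\mathfrak{g}_0$, set $\overline{\alpha}^{(1)} = 2\overline{\alpha}_1 + 3\overline{\alpha}_2 + 4\overline{\alpha}_3 + 6\overline{\alpha}_4 + 4\overline{\alpha}_5 + 2\overline{\alpha}_6 = \overline{\Lambda}_4$, $\overline{\alpha}^{(2)} = \overline{\alpha}_1 + \overline{\alpha}_2 + 2\overline{\alpha}_3 + 3\overline{\alpha}_4 + 2\overline{\alpha}_5 + \overline{\alpha}_6 = \overline{\Lambda}_4 - \overline{\Lambda}_2$, $\overline{\alpha}^{(3)} = \overline{\alpha}_2 + \overline{\alpha}_3 + 2\overline{\alpha}_4 + \overline{\alpha}_5 = \overline{\Lambda}_4 - \overline{\Lambda}_1 - \overline{\Lambda}_6$, $\overline{\alpha}^{(4)} = \overline{\alpha}_2 + \overline{\alpha}_4 = \overline{\Lambda}_2 + \overline{\Lambda}_4 - \overline{\Lambda}_3 - \overline{\Lambda}_5$, $\overline{\alpha}^{(5)} = \overline{\alpha}_2 = 2\overline{\Lambda}_2 - \overline{\Lambda}_4$. The highest weight rigged configurations of $B^{4,s}$ are indexed by $k_1,\dots,k_5 \in \mathbb{Z}_{\geq 0}$ with $k_1+k_2+k_3+k_4 \leq s$ and $k_2 \geq k_4 + 2k_5$, together with a rigging $x$ with $0 \leq x \leq k_2 - k_4 - 2k_5$; such a rigged configuration has classical weight $s\overline{\Lambda}_4 -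 \sum_{i=1}^5 k_i \overline{\alpha}^{(i)}$ and cocharge $3k_1 + k_2 + k_3 + k_4 + k_5 + x$. The statement says this rigged-configuration decomposition agrees with the graded decomposition conjectured by Hatayama--Kuniba--Okado--Takagi--Yamada. -}

module Defs where

open import Data.Nat as ℕ using (ℕ; zero; suc; _≤_; _≤?_; _⊓_; _∸_)
open import Data.Integer as ℤ using (ℤ; +_; _-_)
open import Data.Vec as Vec using (Vec; []; _∷_; zipWith; map; replicate)
open import Data.List as List using (List; upTo; concatMap; filter; applyUpTo)
open import Data.Product using (_×_; _,_)
open import Relation.Nullary.Decidable using (_×-dec_)
open import Relation.Nullary using (Dec)

-- Classical weights of g₀ = E₆, written in the basis of fundamental weights
-- Λ̄₁,…,Λ̄₆ (coordinate i = coefficient of Λ̄ᵢ, Kac/Bourbaki labelling).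
Weight : Set
Weight = Vec ℤ 6

infixl 6 _+ʷ_ _-ʷ_
infixr 7 _·ʷ_

_+ʷ_ : Weight → Weight → Weight
_+ʷ_ = zipWith ℤ._+_

_-ʷ_ : Weight → Weight → Weight
_-ʷ_ = zipWith _-_

_·ʷ_ : ℕ → Weight → Weight
n ·ʷ v = map (ℤ._*_ (+ n)) v

0ʷ : Weight
0ʷ = replicate 6 (+ 0)

Λ₁ Λ₂ Λ₃ Λ₄ Λ₅ Λ₆ : Weight
Λ₁ = + 1 ∷ + 0 ∷ + 0 ∷ + 0 ∷ + 0 ∷ + 0 ∷ []
Λ₂ = + 0 ∷ + 1 ∷ + 0 ∷ + 0 ∷ + 0 ∷ + 0 ∷ []
Λ₃ = + 0 ∷ + 0 ∷ + 1 ∷ + 0 ∷ + 0 ∷ + 0 ∷ []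
Λ₄ = + 0 ∷ + 0 ∷ + 0 ∷ + 1 ∷ + 0 ∷ + 0 ∷ []
Λ₅ = + 0 ∷ + 0 ∷ + 0 ∷ + 0 ∷ + 1 ∷ + 0 ∷ []
Λ₆ = + 0 ∷ + 0 ∷ + 0 ∷ + 0 ∷ + 0 ∷ + 1 ∷ []

ᾱ⁽¹⁾ ᾱ⁽²⁾ ᾱ⁽³⁾ ᾱ⁽⁴⁾ ᾱ⁽⁵⁾ : Weight
ᾱ⁽¹⁾ = Λ₄
ᾱ⁽²⁾ = Λ₄ -ʷ Λ₂
ᾱ⁽³⁾ = (Λ₄ -ʷ Λ₁) -ʷ Λ₆
ᾱ⁽⁴⁾ = ((Λ₂ +ʷ Λ₄) -ʷ Λ₃) -ʷ Λ₅
ᾱ⁽⁵⁾ = (2 ·ʷ Λ₂) -ʷ Λ₄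

range : ℕ → List ℕ
range n = upTo (suc n)

-- A graded decomposition ⊕ q^d B(λ) is recorded as the multiset (list up to
-- permutation) of pairs (λ , d): highest weight and grade.
GradedDecomp : Set
GradedDecomp = List (Weight × ℤ)

-- Highest weight rigged configurations of B^{4,s}:
-- data (k₁,k₂,k₃,k₄,k₅,x) with k₁+k₂+k₃+k₄ ≤ s, k₂ ≥ k₄ + 2k₅,
-- 0 ≤ x ≤ k₂ - k₄ - 2k₅.  (All such entries are ≤ s, so enumerating a box
-- [0..s]⁶ and filtering by the defining conditions yields all of them.)

RCData : Set
RCData = ℕ × ℕ × ℕ × ℕ × ℕ × ℕ

IsHWRC : ℕ → RCData → Set
IsHWRC s (k₁ , k₂ , k₃ , k₄ , k₅ , x) =
  (k₁ ℕ.+ k₂ ℕ.+ k₃ ℕ.+ k₄ ≤ s) × (k₄ ℕ.+ 2 ℕ.* k₅ ≤ k₂) × (x ≤ k₂ ∸ (k₄ ℕ.+ 2 ℕ.* k₅))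

isHWRC? : (s : ℕ) → (r : RCData) → Dec (IsHWRC s r)
isHWRC? s (k₁ , k₂ , k₃ , k₄ , k₅ , x) =
  (k₁ ℕ.+ k₂ ℕ.+ k₃ ℕ.+ k₄ ≤? s) ×-dec (k₄ ℕ.+ 2 ℕ.* k₅ ≤? k₂) ×-dec (x ≤? k₂ ∸ (k₄ ℕ.+ 2 ℕ.* k₅))

box6 : ℕ → List RCData
box6 s =
  concatMap (λ k₁ → concatMap (λ k₂ → concatMap (λ k₃ → concatMap (λ k₄ →
  concatMap (λ k₅ → List.map (λ x → (k₁ , k₂ , k₃ , k₄ , k₅ , x)) (range s))
  (range s)) (range s)) (range s)) (range s)) (range s)

hwRC : ℕ → List RCData
hwRC s = filter (isHWRC? s) (box6 s)

rcWeight : ℕ → RCData → Weight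
rcWeight s (k₁ , k₂ , k₃ , k₄ , k₅ , x) =
  ((((s ·ʷ Λ₄) -ʷ (k₁ ·ʷ ᾱ⁽¹⁾)) -ʷ (k₂ ·ʷ ᾱ⁽²⁾)) -ʷ (k₃ ·ʷ ᾱ⁽³⁾)) -ʷ (k₄ ·ʷ ᾱ⁽⁴⁾)
    -ʷ (k₅ ·ʷ ᾱ⁽⁵⁾)

cocharge : RCData → ℕ
cocharge (k₁ , k₂ , k₃ , k₄ , k₅ , x) = 3 ℕ.* k₁ ℕ.+ k₂ ℕ.+ k₃ ℕ.+ k₄ ℕ.+ k₅ ℕ.+ x

B4s-graded : ℕ → GradedDecomp
B4s-graded s = List.map (λ r → rcWeight s r , + cocharge r) (hwRC s)

JData : Set
JData = ℕ × ℕ × ℕ × ℕ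

IsJ : ℕ → JData → Set
IsJ s (j₁ , j₂ , j₃ , j₄) = j₁ ℕ.+ j₂ ℕ.+ 2 ℕ.* j₃ ℕ.+ j₄ ≤ s

isJ? : (s : ℕ) → (j : JData) → Dec (IsJ s j)
isJ? s (j₁ , j₂ , j₃ , j₄) = j₁ ℕ.+ j₂ ℕ.+ 2 ℕ.* j₃ ℕ.+ j₄ ≤? s

box4 : ℕ → List JData
box4 s =
  concatMap (λ j₁ → concatMap (λ j₂ → concatMap (λ j₃ →
  List.map (λ j₄ → (j₁ , j₂ , j₃ , j₄)) (range s)) (range s)) (range s)) (range s)

validJ : ℕ → List JData
validJ s = filter (isJ? s) (box4 s)

-- min(1 + j₂, 1 + s - j₁ - j₂ - 2j₃ - j₄)  (second argument is ≥ 1 on validJ,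
-- so truncated subtraction agrees with integer subtraction there)
multJ : ℕ → JData → ℕ
multJ s (j₁ , j₂ , j₃ , j₄) = (1 ℕ.+ j₂) ⊓ (1 ℕ.+ s ∸ (j₁ ℕ.+ j₂ ℕ.+ 2 ℕ.* j₃ ℕ.+ j₄))

gradeJ : ℕ → JData → ℤ
gradeJ s (j₁ , j₂ , j₃ , j₄) =
  + (3 ℕ.* s) - + (2 ℕ.* j₁) - + (3 ℕ.* j₂) - + (4 ℕ.* j₃) - + (2 ℕ.* j₄)

weightJ : JData → Weight
weightJ (j₁ , j₂ , j₃ , j₄) =
  (j₁ ·ʷ Λ₂) +ʷ (j₂ ·ʷ Λ₄) +ʷ (j₃ ·ʷ (Λ₃ +ʷ Λ₅)) +ʷ (j₄ ·ʷ (Λ₁ +ʷ Λ₆))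

summandJ : ℕ → JData → GradedDecomp
summandJ s j@(j₁ , _ , _ , _) =
  concatMap (λ _ → List.map (λ k → weightJ j , gradeJ s j ℤ.+ + k) (range j₁))
            (upTo (multJ s j))

HKOTY-graded : ℕ → GradedDecomp
HKOTY-graded s = concatMap (summandJ s) (validJ s)

-- A highest weight rigged configuration (k₁,k₂,k₃,k₄,k₅,x) of B^{4,s} is
-- determined by k₁, k₃, k₄, k₅, x and the slacks u = s − (k₁+k₂+k₃+k₄) and
-- y = k₂ − (k₄+2k₅) − x of its defining inequalities, and these seven numbers
-- are arbitrary.  The same seven numbers index the terms of the HKOTY sum:
-- j = (x+y, k₅+u, k₄, k₃), copy number k₅ < min(1+j₂, 1+s−|j|) and shift
-- x ≤ j₁, with s − |j| − k₅ = k₁.  Under this correspondence the classical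
-- weights agree coordinatewise and the cocharge equals the HKOTY grade, both
-- being linear identities in the seven parameters.
module Submission where

open import Defs
open import Data.Nat using (ℕ; suc; NonZero)
open import Data.List.Relation.Binary.Permutation.Propositional using (_↭_)
open import Data.List.Relation.Binary.Permutation.Propositional using (↭-sym; module PermutationReasoning)

open import Data.Nat using (_+_; _*_; _∸_; _≤_; _<_; s≤s)
open import Data.Nat.Properties
  using ( ≤-trans; ≤-reflexive; ≤-pred; m≤m+n; m≤n+m; m≤n⇒m≤n+o; m≤n⇒m≤o+n; m∸n≤m
        ; m+n∸m≡n; ∸-+-assoc; +-∸-assoc; +-comm; m≤n⇒∃[o]m+o≡n; m+n≤o⇒m≤o∸n
        ; m≤o∸n⇒m+n≤o; m<n⊓o⇒m<n; m<n⊓o⇒m<o; ⊓-pres-m< )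
import Data.Nat.Tactic.RingSolver as ℕ-Solver
open import Data.Integer as ℤ using (ℤ; +_)
import Data.Integer.Properties as ℤ
import Data.Integer.Tactic.RingSolver as ℤ-Solver
open import Data.Vec as Vec using ()
open import Data.Vec.Relation.Binary.Pointwise.Inductive using (Pointwise-≡⇒≡; []; _∷_)
open import Data.Product using (Σ; _×_; _,_; proj₁; proj₂)
open import Data.Product.Properties using (,-injectiveʳ)
open import Data.List using (List; []; _∷_; map; concatMap; upTo)
open import Data.List.Properties using (map-∘; map-id; map-cong-local; map-concatMap; concatMap-cong)
open import Data.List.Relation.Unary.All as All using ()
open import Data.List.Relation.Unary.Unique.Propositional using (Unique)
import Data.List.Relation.Unary.Unique.Propositional.Properties as Unique
open import Data.List.Relation.Unary.AllPairs using ([]; _∷_)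
open import Data.List.Membership.Propositional using (_∈_; find; lose)
open import Data.List.Membership.Propositional.Properties
  using (∈-concatMap⁺; ∈-concatMap⁻; ∈-filter⁺; ∈-filter⁻; ∈-upTo⁺; ∈-upTo⁻; ∈-map⁺; ∈-map⁻)
open import Data.List.Membership.Propositional.Properties.WithK using (unique∧set⇒bag)
open import Data.List.Relation.Binary.BagAndSetEquality using (∼bag⇒↭)
open import Data.List.Relation.Binary.Disjoint.Propositional using (Disjoint)
import Data.List.Relation.Binary.Permutation.Propositional.Properties as ↭
open import Function using (_∘_; id; mk⇔)
open import Relation.Binary.PropositionalEquality

module _ {A B : Set} where

  infixr 5 _⋉_

  -- Opaque, so that unification treats xs ⋉ g as rigid and can infer xs and g.
  opaque

    _⋉_ : List A → (A → List B) → List (A × B)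
    xs ⋉ g = concatMap (λ x → map (x ,_) (g x)) xs

    ∈-⋉⁺ : ∀ {xs g x y} → x ∈ xs → y ∈ g x → (x , y) ∈ xs ⋉ g
    ∈-⋉⁺ {x = x} x∈xs y∈gx = ∈-concatMap⁺ _ (lose x∈xs (∈-map⁺ (x ,_) y∈gx))

    ∈-⋉⁻ : ∀ {xs g x y} → (x , y) ∈ xs ⋉ g → x ∈ xs × y ∈ g x
    ∈-⋉⁻ {xs} p with find (∈-concatMap⁻ _ {xs = xs} p)
    ... | x′ , x′∈xs , q with ∈-map⁻ (x′ ,_) q
    ... | _ , y∈gx′ , refl = x′∈xs , y∈gx′

    Unique-⋉ : ∀ {xs g} → Unique xs → (∀ x → Unique (g x)) → Unique (xs ⋉ g)
    Unique-⋉ {[]}     []             _  = []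
    Unique-⋉ {x ∷ xs} {g} (x∉xs ∷ xs!) g! =
      Unique.++⁺ (Unique.map⁺ ,-injectiveʳ (g! x)) (Unique-⋉ xs! g!) disjoint
      where
      disjoint : Disjoint (map (x ,_) (g x)) (xs ⋉ g)
      disjoint (p , q) with ∈-map⁻ (x ,_) p
      ... | _ , _ , refl = All.lookup x∉xs (proj₁ (∈-⋉⁻ q)) refl

    concatMap≡map-⋉ : ∀ {C : Set} {f : A → List C} {p : A × B → C} {g} xs →
                      (∀ x → f x ≡ map (p ∘ (x ,_)) (g x)) → concatMap f xs ≡ map p (xs ⋉ g)
    concatMap≡map-⋉ {f = f} {p} {g} xs eq = begin
      concatMap f xs                                  ≡⟨ concatMap-cong (λ x → trans (eq x) (map-∘ (g x))) xs ⟩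
      concatMap (map p ∘ λ x → map (x ,_) (g x)) xs  ≡⟨ map-concatMap p _ xs ⟨
      map p (xs ⋉ g)                                  ∎
      where open ≡-Reasoning

module _ {A B : Set} {f : A → B} {g : B → A} {xs : List A} {ys : List B} where

  map-↭-inverseOn : Unique xs → Unique ys →
                    (∀ {x} → x ∈ xs → f x ∈ ys) → (∀ {y} → y ∈ ys → g y ∈ xs) →
                    (∀ {x} → x ∈ xs → g (f x) ≡ x) → (∀ {y} → y ∈ ys → f (g y) ≡ y) →
                    map f xs ↭ ys
  map-↭-inverseOn xs! ys! f∈ g∈ gf fg = ∼bag⇒↭ (unique∧set⇒bag fxs! ys! (mk⇔ to from))
    where
    gfxs≡xs : map g (map f xs) ≡ xs
    gfxs≡xs = trans (sym (map-∘ xs)) (trans (map-cong-local (All.tabulate gf)) (map-id xs))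

    fxs! : Unique (map f xs)
    fxs! = Unique.map⁻ (subst Unique (sym gfxs≡xs) xs!)

    to : ∀ {y} → y ∈ map f xs → y ∈ ys
    to p with ∈-map⁻ f p
    ... | _ , x∈xs , refl = f∈ x∈xs

    from : ∀ {y} → y ∈ ys → y ∈ map f xs
    from y∈ys = subst (_∈ map f xs) (fg y∈ys) (∈-map⁺ f (g∈ y∈ys))

∈-range⁺ : ∀ {k n} → k ≤ n → k ∈ range n
∈-range⁺ k≤n = ∈-upTo⁺ (s≤s k≤n)

∈-range⁻ : ∀ {k n} → k ∈ range n → k ≤ n
∈-range⁻ k∈ = ≤-pred (∈-upTo⁻ k∈)

Unique-range : ∀ n → Unique (range n)
Unique-range n = Unique.upTo⁺ (suc n)

cube6 : ℕ → List RCData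
cube6 s = R ⋉ λ _ → R ⋉ λ _ → R ⋉ λ _ → R ⋉ λ _ → R ⋉ λ _ → R
  where R : List ℕ
        R = range s

cube4 : ℕ → List JData
cube4 s = R ⋉ λ _ → R ⋉ λ _ → R ⋉ λ _ → R
  where R : List ℕ
        R = range s

box6≡cube6 : ∀ s → box6 s ≡ cube6 s
box6≡cube6 s = trans
  (concatMap≡map-⋉ {p = id} _ λ _ → concatMap≡map-⋉ _ λ _ → concatMap≡map-⋉ _ λ _ →
   concatMap≡map-⋉ _ λ _ → concatMap≡map-⋉ _ λ _ → refl)
  (map-id (cube6 s))

box4≡cube4 : ∀ s → box4 s ≡ cube4 s
box4≡cube4 s = trans
  (concatMap≡map-⋉ {p = id} _ λ _ → concatMap≡map-⋉ _ λ _ → concatMap≡map-⋉ _ λ _ → refl)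
  (map-id (cube4 s))

Unique-hwRC : ∀ s → Unique (hwRC s)
Unique-hwRC s = Unique.filter⁺ (isHWRC? s) {box6 s} (subst Unique (sym (box6≡cube6 s))
  (Unique-⋉ R! λ _ → Unique-⋉ R! λ _ → Unique-⋉ R! λ _ → Unique-⋉ R! λ _ → Unique-⋉ R! λ _ → R!))
  where
  R! : Unique (range s)
  R! = Unique-range s

∈-hwRC⁺ : ∀ {s r} → IsHWRC s r → r ∈ hwRC s
∈-hwRC⁺ {s} {k₁ , k₂ , k₃ , k₄ , k₅ , x} hw@(Σk≤s , k₄+2k₅≤k₂ , x≤k₂∸k₄+2k₅) =
  ∈-filter⁺ (isHWRC? s) {xs = box6 s} (subst ((k₁ , k₂ , k₃ , k₄ , k₅ , x) ∈_) (sym (box6≡cube6 s))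
    (∈-⋉⁺ (∈-range⁺ k₁≤s) (∈-⋉⁺ (∈-range⁺ k₂≤s) (∈-⋉⁺ (∈-range⁺ k₃≤s)
      (∈-⋉⁺ (∈-range⁺ k₄≤s) (∈-⋉⁺ (∈-range⁺ k₅≤s) (∈-range⁺ x≤s)))))))
    hw
  where
  k₁≤s : k₁ ≤ s
  k₁≤s = ≤-trans (m≤n⇒m≤n+o k₄ (m≤n⇒m≤n+o k₃ (m≤m+n k₁ k₂))) Σk≤s
  k₂≤s : k₂ ≤ s
  k₂≤s = ≤-trans (m≤n⇒m≤n+o k₄ (m≤n⇒m≤n+o k₃ (m≤n+m k₂ k₁))) Σk≤s
  k₃≤s : k₃ ≤ s
  k₃≤s = ≤-trans (m≤n⇒m≤n+o k₄ (m≤n+m k₃ (k₁ + k₂))) Σk≤s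
  k₄≤s : k₄ ≤ s
  k₄≤s = ≤-trans (m≤n+m k₄ (k₁ + k₂ + k₃)) Σk≤s
  k₅≤s : k₅ ≤ s
  k₅≤s = ≤-trans (≤-trans (m≤n⇒m≤o+n k₄ (m≤m+n k₅ _)) k₄+2k₅≤k₂) k₂≤s
  x≤s : x ≤ s
  x≤s = ≤-trans (≤-trans x≤k₂∸k₄+2k₅ (m∸n≤m k₂ (k₄ + 2 * k₅))) k₂≤s

∈-hwRC⁻ : ∀ {s r} → r ∈ hwRC s → IsHWRC s r
∈-hwRC⁻ {s} r∈ = proj₂ (∈-filter⁻ (isHWRC? s) {xs = box6 s} r∈)

Unique-validJ : ∀ s → Unique (validJ s)
Unique-validJ s = Unique.filter⁺ (isJ? s) {box4 s} (subst Unique (sym (box4≡cube4 s))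
  (Unique-⋉ R! λ _ → Unique-⋉ R! λ _ → Unique-⋉ R! λ _ → R!))
  where
  R! : Unique (range s)
  R! = Unique-range s

∈-validJ⁺ : ∀ {s j} → IsJ s j → j ∈ validJ s
∈-validJ⁺ {s} {j₁ , j₂ , j₃ , j₄} Σj≤s =
  ∈-filter⁺ (isJ? s) {xs = box4 s} (subst ((j₁ , j₂ , j₃ , j₄) ∈_) (sym (box4≡cube4 s))
    (∈-⋉⁺ (∈-range⁺ j₁≤s) (∈-⋉⁺ (∈-range⁺ j₂≤s) (∈-⋉⁺ (∈-range⁺ j₃≤s) (∈-range⁺ j₄≤s)))))
    Σj≤s
  where
  j₁≤s : j₁ ≤ s
  j₁≤s = ≤-trans (m≤n⇒m≤n+o j₄ (m≤n⇒m≤n+o (2 * j₃) (m≤m+n j₁ j₂))) Σj≤s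
  j₂≤s : j₂ ≤ s
  j₂≤s = ≤-trans (m≤n⇒m≤n+o j₄ (m≤n⇒m≤n+o (2 * j₃) (m≤n+m j₂ j₁))) Σj≤s
  j₃≤s : j₃ ≤ s
  j₃≤s = ≤-trans (m≤n⇒m≤n+o j₄ (m≤n⇒m≤o+n (j₁ + j₂) (m≤m+n j₃ _))) Σj≤s
  j₄≤s : j₄ ≤ s
  j₄≤s = ≤-trans (m≤n+m j₄ _) Σj≤s

∈-validJ⁻ : ∀ {s j} → j ∈ validJ s → IsJ s j
∈-validJ⁻ {s} j∈ = proj₂ (∈-filter⁻ (isJ? s) {xs = box4 s} j∈)

Index : Set
Index = JData × ℕ × ℕ

hkotyIndex : ℕ → List Index
hkotyIndex s = validJ s ⋉ λ j → upTo (multJ s j) ⋉ λ _ → range (proj₁ j)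

hkotyLabel : ℕ → Index → Weight × ℤ
hkotyLabel s (j , _ , k) = weightJ j , gradeJ s j ℤ.+ + k

HKOTY-graded≡map-hkotyLabel : ∀ s → HKOTY-graded s ≡ map (hkotyLabel s) (hkotyIndex s)
HKOTY-graded≡map-hkotyLabel s =
  concatMap≡map-⋉ (validJ s) λ j → concatMap≡map-⋉ (upTo (multJ s j)) λ _ → refl

Unique-hkotyIndex : ∀ s → Unique (hkotyIndex s)
Unique-hkotyIndex s =
  Unique-⋉ (Unique-validJ s) λ j → Unique-⋉ (Unique.upTo⁺ (multJ s j)) λ _ → Unique-range (proj₁ j)

jSum : JData → ℕ
jSum (j₁ , j₂ , j₃ , j₄) = j₁ + j₂ + 2 * j₃ + j₄

<multJ⇒bounds : ∀ {s m} j → IsJ s j → m < multJ s j → m ≤ proj₁ (proj₂ j) × jSum j + m ≤ s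
<multJ⇒bounds {s} {m} j@(_ , j₂ , _) Σj≤s m<multJ =
  ≤-pred (m<n⊓o⇒m<n (suc j₂) _ m<multJ) ,
  subst (_≤ s) (+-comm m (jSum j))
    (m≤o∸n⇒m+n≤o m Σj≤s (≤-pred (subst (m <_) (+-∸-assoc 1 Σj≤s) (m<n⊓o⇒m<o (suc j₂) _ m<multJ))))

bounds⇒<multJ : ∀ {s m} j → m ≤ proj₁ (proj₂ j) → jSum j + m ≤ s → m < multJ s j
bounds⇒<multJ {s} {m} j m≤j₂ Σj+m≤s =
  ⊓-pres-m< (s≤s m≤j₂)
    (subst (m <_) (sym (+-∸-assoc 1 (≤-trans (m≤m+n (jSum j) m) Σj+m≤s)))
      (s≤s (m+n≤o⇒m≤o∸n m (subst (_≤ s) (+-comm (jSum j) m) Σj+m≤s))))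

record Params : Set where
  constructor params
  field k₁ k₃ k₄ k₅ u x y : ℕ

level : Params → ℕ
level (params k₁ k₃ k₄ k₅ u x y) = k₁ + (k₄ + 2 * k₅ + (x + y)) + k₃ + k₄ + u

config : Params → RCData
config (params k₁ k₃ k₄ k₅ u x y) = k₁ , k₄ + 2 * k₅ + (x + y) , k₃ , k₄ , k₅ , x

index : Params → Index
index (params k₁ k₃ k₄ k₅ u x y) = (x + y , k₅ + u , k₄ , k₃) , k₅ , x

level≡jSum+k₅+k₁ : ∀ p → level p ≡ jSum (proj₁ (index p)) + Params.k₅ p + Params.k₁ p
level≡jSum+k₅+k₁ (params k₁ k₃ k₄ k₅ u x y) = rearrange k₁ k₃ k₄ k₅ u x y
  where
  rearrange : ∀ k₁ k₃ k₄ k₅ u x y →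
              k₁ + (k₄ + 2 * k₅ + (x + y)) + k₃ + k₄ + u ≡ x + y + (k₅ + u) + 2 * k₄ + k₃ + k₅ + k₁
  rearrange = ℕ-Solver.solve-∀

config-IsHWRC : ∀ p → IsHWRC (level p) (config p)
config-IsHWRC (params k₁ k₃ k₄ k₅ u x y) =
  m≤m+n _ u , m≤m+n _ (x + y) , subst (x ≤_) (sym (m+n∸m≡n (k₄ + 2 * k₅) (x + y))) (m≤m+n x y)

IsHWRC⇒config : ∀ {s r} → IsHWRC s r → Σ Params λ p → level p ≡ s × config p ≡ r
IsHWRC⇒config {r = k₁ , k₂ , k₃ , k₄ , k₅ , x} (Σk≤s , k₄+2k₅≤k₂ , x≤k₂∸k₄+2k₅)
  with m≤n⇒∃[o]m+o≡n k₄+2k₅≤k₂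
... | v , refl
  with m≤n⇒∃[o]m+o≡n (subst (x ≤_) (m+n∸m≡n (k₄ + 2 * k₅) v) x≤k₂∸k₄+2k₅) | m≤n⇒∃[o]m+o≡n Σk≤s
... | y , refl | u , refl = params k₁ k₃ k₄ k₅ u x y , refl , refl

index-∈hkotyIndex : ∀ p → index p ∈ hkotyIndex (level p)
index-∈hkotyIndex p@(params k₁ k₃ k₄ k₅ u x y) =
  ∈-⋉⁺ (∈-validJ⁺ (≤-trans (m≤m+n (jSum j) k₅) Σj+k₅≤s))
       (∈-⋉⁺ (∈-upTo⁺ (bounds⇒<multJ j (m≤m+n k₅ u) Σj+k₅≤s)) (∈-range⁺ (m≤m+n x y)))
  where
  j : JData
  j = proj₁ (index p)
  Σj+k₅≤s : jSum j + k₅ ≤ level p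
  Σj+k₅≤s = ≤-trans (m≤m+n (jSum j + k₅) k₁) (≤-reflexive (sym (level≡jSum+k₅+k₁ p)))

∈hkotyIndex⇒index : ∀ {s i} → i ∈ hkotyIndex s → Σ Params λ p → level p ≡ s × index p ≡ i
∈hkotyIndex⇒index {s} {j@(j₁ , j₂ , j₃ , j₄) , m , k} i∈ with ∈-⋉⁻ i∈
... | j∈ , mk∈ with ∈-⋉⁻ mk∈
... | m∈ , k∈ with <multJ⇒bounds j (∈-validJ⁻ j∈) (∈-upTo⁻ m∈)
... | m≤j₂ , Σj+m≤s
  with m≤n⇒∃[o]m+o≡n (∈-range⁻ {n = j₁} k∈) | m≤n⇒∃[o]m+o≡n m≤j₂ | m≤n⇒∃[o]m+o≡n Σj+m≤s
... | y , refl | u , refl | k₁ , refl =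
  params k₁ j₄ j₃ m u k y , level≡jSum+k₅+k₁ (params k₁ j₄ j₃ m u k y) , refl

φ : ℕ → Index → RCData
φ s (j@(j₁ , _ , j₃ , j₄) , m , k) = s ∸ jSum j ∸ m , j₃ + 2 * m + j₁ , j₄ , j₃ , m , k

ψ : ℕ → RCData → Index
ψ s (k₁ , k₂ , k₃ , k₄ , k₅ , x) =
  (k₂ ∸ (k₄ + 2 * k₅) , k₅ + (s ∸ (k₁ + k₂ + k₃ + k₄)) , k₄ , k₃) , k₅ , x

φ-index : ∀ p → φ (level p) (index p) ≡ config p
φ-index p@(params k₁ k₃ k₄ k₅ u x y) = cong (_, _) (begin
  level p ∸ jSum j ∸ k₅             ≡⟨ cong (λ n → n ∸ jSum j ∸ k₅) (level≡jSum+k₅+k₁ p) ⟩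
  jSum j + k₅ + k₁ ∸ jSum j ∸ k₅    ≡⟨ ∸-+-assoc (jSum j + k₅ + k₁) (jSum j) k₅ ⟩
  jSum j + k₅ + k₁ ∸ (jSum j + k₅)  ≡⟨ m+n∸m≡n (jSum j + k₅) k₁ ⟩
  k₁                                ∎)
  where
  open ≡-Reasoning
  j : JData
  j = proj₁ (index p)

ψ-config : ∀ p → ψ (level p) (config p) ≡ index p
ψ-config (params k₁ k₃ k₄ k₅ u x y) =
  cong₂ (λ j₁ v → (j₁ , k₅ + v , k₄ , k₃) , k₅ , x)
        (m+n∸m≡n (k₄ + 2 * k₅) (x + y))
        (m+n∸m≡n (k₁ + (k₄ + 2 * k₅ + (x + y)) + k₃ + k₄) u)

φ-∈ : ∀ {s i} → i ∈ hkotyIndex s → φ s i ∈ hwRC s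
φ-∈ i∈ with ∈hkotyIndex⇒index i∈
... | p , refl , refl = subst (_∈ hwRC (level p)) (sym (φ-index p)) (∈-hwRC⁺ (config-IsHWRC p))

ψ-∈ : ∀ {s r} → r ∈ hwRC s → ψ s r ∈ hkotyIndex s
ψ-∈ {s} {r} r∈ with IsHWRC⇒config {s} {r} (∈-hwRC⁻ r∈)
... | p , refl , refl = subst (_∈ hkotyIndex (level p)) (sym (ψ-config p)) (index-∈hkotyIndex p)

ψ∘φ : ∀ {s i} → i ∈ hkotyIndex s → ψ s (φ s i) ≡ i
ψ∘φ i∈ with ∈hkotyIndex⇒index i∈
... | p , refl , refl = trans (cong (ψ (level p)) (φ-index p)) (ψ-config p)

φ∘ψ : ∀ {s r} → r ∈ hwRC s → φ s (ψ s r) ≡ r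
φ∘ψ {s} {r} r∈ with IsHWRC⇒config {s} {r} (∈-hwRC⁻ r∈)
... | p , refl , refl = trans (cong (φ (level p)) (ψ-config p)) (φ-index p)

map-φ-↭ : ∀ s → map (φ s) (hkotyIndex s) ↭ hwRC s
map-φ-↭ s = map-↭-inverseOn (Unique-hkotyIndex s) (Unique-hwRC s) φ-∈ ψ-∈ ψ∘φ φ∘ψ

rcLabel : ℕ → RCData → Weight × ℤ
rcLabel s r = rcWeight s r , + cocharge r

infixr 7 _·ᶻ_

_·ᶻ_ : ℤ → Weight → Weight
c ·ᶻ v = Vec.map (c ℤ.*_) v

-- D stands for + (2 * k₅): under +_, addition in ℕ becomes addition in ℤ
-- definitionally, but multiplication does not.
weight-identity : ∀ K₁ K₃ K₄ K₅ U X Y {D} → D ≡ + 2 ℤ.* K₅ →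
  let K₂ = K₄ ℤ.+ D ℤ.+ (X ℤ.+ Y) in
  (K₁ ℤ.+ K₂ ℤ.+ K₃ ℤ.+ K₄ ℤ.+ U) ·ᶻ Λ₄ -ʷ K₁ ·ᶻ ᾱ⁽¹⁾ -ʷ K₂ ·ᶻ ᾱ⁽²⁾ -ʷ K₃ ·ᶻ ᾱ⁽³⁾ -ʷ K₄ ·ᶻ ᾱ⁽⁴⁾
    -ʷ K₅ ·ᶻ ᾱ⁽⁵⁾
  ≡ (X ℤ.+ Y) ·ᶻ Λ₂ +ʷ (K₅ ℤ.+ U) ·ᶻ Λ₄ +ʷ K₄ ·ᶻ (Λ₃ +ʷ Λ₅) +ʷ K₃ ·ᶻ (Λ₁ +ʷ Λ₆)
weight-identity K₁ K₃ K₄ K₅ U X Y refl = Pointwise-≡⇒≡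
  (solve vs ∷ solve vs ∷ solve vs ∷ solve vs ∷ solve vs ∷ solve vs ∷ [])
  where
  open ℤ-Solver using (solve)
  vs : List ℤ
  vs = K₁ ∷ K₃ ∷ K₄ ∷ K₅ ∷ U ∷ X ∷ Y ∷ []

rcWeight-config : ∀ p → rcWeight (level p) (config p) ≡ weightJ (proj₁ (index p))
rcWeight-config (params k₁ k₃ k₄ k₅ u x y) =
  weight-identity (+ k₁) (+ k₃) (+ k₄) (+ k₅) (+ u) (+ x) (+ y) (ℤ.pos-* 2 k₅)

cocharge-config : ∀ p → + cocharge (config p) ≡ gradeJ (level p) (proj₁ (index p)) ℤ.+ + Params.x p
cocharge-config (params k₁ k₃ k₄ k₅ u x y) = sym (trans
  (cong (λ n → + n ℤ.- + a ℤ.- + b ℤ.- + c ℤ.- + d ℤ.+ + x) (rearrange k₁ k₃ k₄ k₅ u x y))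
  (cancel (+ a) (+ b) (+ c) (+ d) (+ e) (+ x)))
  where
  a b c d e : ℕ
  a = 2 * (x + y)
  b = 3 * (k₅ + u)
  c = 4 * k₄
  d = 2 * k₃
  e = 3 * k₁ + (k₄ + 2 * k₅ + (x + y)) + k₃ + k₄ + k₅
  rearrange : ∀ k₁ k₃ k₄ k₅ u x y →
              3 * (k₁ + (k₄ + 2 * k₅ + (x + y)) + k₃ + k₄ + u)
              ≡ 2 * (x + y) + 3 * (k₅ + u) + 4 * k₄ + 2 * k₃
                + (3 * k₁ + (k₄ + 2 * k₅ + (x + y)) + k₃ + k₄ + k₅)
  rearrange = ℕ-Solver.solve-∀
  cancel : ∀ A B C D E K → A ℤ.+ B ℤ.+ C ℤ.+ D ℤ.+ E ℤ.- A ℤ.- B ℤ.- C ℤ.- D ℤ.+ K ≡ E ℤ.+ K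
  cancel = ℤ-Solver.solve-∀

rcLabel-config : ∀ p → rcLabel (level p) (config p) ≡ hkotyLabel (level p) (index p)
rcLabel-config p = cong₂ _,_ (rcWeight-config p) (cocharge-config p)

rcLabel∘φ : ∀ {s i} → i ∈ hkotyIndex s → rcLabel s (φ s i) ≡ hkotyLabel s i
rcLabel∘φ i∈ with ∈hkotyIndex⇒index i∈
... | p , refl , refl = trans (cong (rcLabel (level p)) (φ-index p)) (rcLabel-config p)

-- The identity holds for s = 0 as well.
proposition9p11 : (s : ℕ) → .{{_ : NonZero s}} → B4s-graded s ↭ HKOTY-graded s
proposition9p11 s = begin
  map (rcLabel s) (hwRC s)                    ↭⟨ ↭.map⁺ (rcLabel s) (↭-sym (map-φ-↭ s)) ⟩
  map (rcLabel s) (map (φ s) (hkotyIndex s))  ≡⟨ map-∘ (hkotyIndex s) ⟨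
  map (rcLabel s ∘ φ s) (hkotyIndex s)        ≡⟨ map-cong-local (All.tabulate rcLabel∘φ) ⟩
  map (hkotyLabel s) (hkotyIndex s)           ≡⟨ HKOTY-graded≡map-hkotyLabel s ⟨
  HKOTY-graded s                              ∎
  where open PermutationReasoning
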